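{- Let $G=(V,E)$ be a connected claw-free graph on $n$ vertices with $a(G)=\frac{n-1}{2}$. Then there exists a vertex $v\in V$ that is not contained in every maximum independent set of $G$ (i.e. some maximum independent set of $G$ avoids $v$) such that $G-v$ is still connected.
   Context: All graphs are finite and simple. A graph is claw-free if it contains no induced subgraph isomorphic to $K_{1,3}$. The annihilation number $a(G)$: if $d_1\leq \dots\leq d_n$ are the vertex degrees of $G$ in nondecreasing order, $a(G)$ is the largest $k$ such that $\sum_{i=1}^k d_i\leq |E|$. $G-v$ denotes the graph obtained by deleting $v$ and its incident edges. -}

module Defs where

open import Data.Nat using (ℕ; zero; suc; _+_; _≤_; _<ᵇ_)
open import Data.Nat.Properties using (≤-decTotalOrder)
open import Data.Bool using (Bool; true; false; _∧_; if_then_else_)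
open import Data.Fin using (Fin; toℕ)
open import Data.Fin.Subset using (Subset; _∈_; _∉_; ∣_∣)
open import Data.List using (List; []; _∷_; map; take; allFin)
open import Data.Nat.ListAction using (sum)
open import Data.Product using (Σ; _×_; _,_; ∃; ∃-syntax)
open import Data.Sum using (_⊎_)
open import Data.Empty using (⊥)
open import Relation.Nullary using (¬_)
open import Relation.Binary.PropositionalEquality using (_≡_; _≢_)
open import Data.List.Sort ≤-decTotalOrder using (sort)

record Graph (n : ℕ) : Set where
  field
    adj    : Fin n → Fin n → Bool
    sym    : ∀ u v → adj u v ≡ adj v u
    irrefl : ∀ v → adj v v ≡ false
open Graph public

countᵇ : ∀ {A : Set} → (A → Bool) → List A → ℕ
countᵇ p []       = 0
countᵇ p (x ∷ xs) = (if p x then 1 else 0) + countᵇ p xs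

deg : ∀ {n} → Graph n → Fin n → ℕ
deg {n} G v = countᵇ (adj G v) (allFin n)

edgeCount : ∀ {n} → Graph n → ℕ
edgeCount {n} G =
  sum (map (λ u → countᵇ (λ w → (toℕ u <ᵇ toℕ w) ∧ adj G u w) (allFin n)) (allFin n))

sortedDegrees : ∀ {n} → Graph n → List ℕ
sortedDegrees {n} G = sort (map (deg G) (allFin n))

IsAnnihilationNumber : ∀ {n} → Graph n → ℕ → Set
IsAnnihilationNumber {n} G k =
  k ≤ n × sum (take k (sortedDegrees G)) ≤ edgeCount G
  × (∀ j → j ≤ n → sum (take j (sortedDegrees G)) ≤ edgeCount G → j ≤ k)

ClawFree : ∀ {n} → Graph n → Set
ClawFree G = ∀ c x y z →
  adj G c x ≡ true → adj G c y ≡ true → adj G c z ≡ true →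
  x ≢ y → x ≢ z → y ≢ z →
  adj G x y ≡ true ⊎ adj G x z ≡ true ⊎ adj G y z ≡ true

data WalkAvoiding {n} (G : Graph n) (bad : Fin n → Set) : Fin n → Fin n → Set where
  here : ∀ {u} → (bad u → ⊥) → WalkAvoiding G bad u u
  step : ∀ {u w x} → (bad u → ⊥) → adj G u w ≡ true →
         WalkAvoiding G bad w x → WalkAvoiding G bad u x

NoVertex : ∀ {n} → Fin n → Set
NoVertex _ = ⊥

Connected : ∀ {n} → Graph n → Set
Connected {n} G = ∀ (u w : Fin n) → WalkAvoiding G NoVertex u w

ConnectedMinus : ∀ {n} → Graph n → Fin n → Set
ConnectedMinus {n} G v = ∀ (u w : Fin n) → u ≢ v → w ≢ v → WalkAvoiding G (λ x → x ≡ v) u w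

Independent : ∀ {n} → Graph n → Subset n → Set
Independent G S = ∀ u w → u ∈ S → w ∈ S → adj G u w ≡ false

MaximumIndependent : ∀ {n} → Graph n → Subset n → Set
MaximumIndependent {n} G S = Independent G S × (∀ (T : Subset n) → Independent G T → ∣ T ∣ ≤ ∣ S ∣)

-- The hypothesis a(G) = (n − 1)/2 forces minimum degree 2. With n = 2a + 1 and sorted
-- degrees d₁ ≤ … ≤ dₙ, maximality of a gives |E| < d₁ + L, where L = d₂ + … + d_{a+1}, while
-- 2|E| = d₁ + L + U with L ≤ U = d_{a+2} + … + dₙ; hence 2|E| + 2 ≤ 2d₁ + 2L ≤ d₁ + 2|E|.
-- A connected graph of minimum degree 2 has two adjacent non-cut vertices: among the
-- components of the graphs G − c take a minimal one; a cut vertex inside it would split off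
-- a smaller one, so any vertex of it and a neighbour other than c will do. A maximum
-- independent set misses one of these two vertices.

module Submission where

open import Defs hiding (sym)
open import Data.Nat using (ℕ; zero; suc; _+_; _*_; _∸_; _⊓_; _≤_; _<_; _<ᵇ_; _≤?_; z≤n; s≤s; s≤s⁻¹)
open import Data.Nat.Properties
  using ( ≤-decTotalOrder; +-0-commutativeMonoid; module ≤-Reasoning
        ; ≤-reflexive; ≤-trans; ≤-antisym; <-≤-trans; ≰⇒>; 1+n≰n; suc-injective
        ; +-comm; +-suc; +-identityʳ; +-mono-≤; +-monoʳ-≤; +-cancelʳ-≤; m≤m+n; m⊓n≤m; m+n∸m≡n )
open import Data.Nat.ListAction using (sum)
open import Data.Nat.ListAction.Properties using (sum-↭; sum-++)
open import Data.Nat.Solver using (module +-*-Solver)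
open import Data.Bool using (Bool; true; false; _∧_; if_then_else_)
open import Data.Bool.Properties using (∧-zeroʳ; ∧-identityʳ) renaming (_≟_ to _≟ᵇ_)
open import Data.Fin using (Fin; zero; suc; toℕ)
open import Data.Fin.Properties using (toℕ-injective; any?; all?; _≟_) renaming (suc-injective to fsuc-injective)
open import Data.Fin.Subset using (Subset; _∈_; _∉_; _⊂_; _∪_; ⁅_⁆; ⊥; ∣_∣)
open import Data.Fin.Subset.Properties
  using ( _∈?_; ∉⊥; ∈⊤; x∈⁅x⁆; x∈⁅y⁆⇒x≡y; p⊆p∪q; x∈p∪q⁺; x∈p∪q⁻
        ; ∣p∣≤n; ∣p∣≡n⇒p≡⊤; p⊂q⇒∣p∣<∣q∣; anySubset? )
open import Data.List using ([]; _∷_; _++_; map; take; drop; length; tabulate; allFin)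
open import Data.List.Properties
  using (map-tabulate; take++drop≡id; length-take; length-drop; length-map; length-tabulate)
open import Data.List.Membership.Propositional using () renaming (_∈_ to _∈ˡ_)
open import Data.List.Membership.Propositional.Properties using (∈-map⁺; ∈-allFin)
open import Data.List.Relation.Unary.All as All using (All; []; _∷_)
open import Data.List.Relation.Unary.All.Properties using (++⁻ʳ)
open import Data.List.Relation.Unary.AllPairs using (AllPairs; []; _∷_)
open import Data.List.Relation.Unary.Linked.Properties using (Linked⇒AllPairs)
open import Data.List.Relation.Binary.Permutation.Propositional using (↭-sym)
open import Data.List.Relation.Binary.Permutation.Propositional.Properties using (↭-length; ∈-resp-↭)
open import Data.List.Sort ≤-decTotalOrder using (sort-↭; sort-↗)
open import Algebra.Properties.CommutativeMonoid.Sum +-0-commutativeMonoid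
  using (sum-syntax; sum-cong-≗; sum-replicate-zero; ∑-distrib-+; ∑-comm)
open import Data.Product using (∃-syntax; ∃₂; _×_; _,_; proj₁; proj₂)
open import Data.Sum using (inj₁; inj₂)
open import Data.Empty using (⊥-elim)
open import Function.Bundles using (_⇔_; mk⇔; Equivalence)
open import Relation.Nullary using (¬_; Dec; yes; no; ¬?; _→-dec_)
open import Relation.Nullary.Decidable using (_×-dec_; decidable-stable) renaming (map to Dec-map)
open import Relation.Unary using (Decidable)
open import Relation.Binary.PropositionalEquality

indicator : Bool → ℕ
indicator b = if b then 1 else 0

countᵇ-tabulate : ∀ {A : Set} {m} (p : A → Bool) (f : Fin m → A) →
                  countᵇ p (tabulate f) ≡ ∑[ i < m ] indicator (p (f i))
countᵇ-tabulate {m = zero}  p f = refl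
countᵇ-tabulate {m = suc m} p f = cong (indicator (p (f zero)) +_) (countᵇ-tabulate p (λ i → f (suc i)))

sum-tabulate : ∀ {m} (f : Fin m → ℕ) → sum (tabulate f) ≡ ∑[ i < m ] f i
sum-tabulate {zero}  f = refl
sum-tabulate {suc m} f = cong (f zero +_) (sum-tabulate (λ i → f (suc i)))

∑-indicator-≤1 : ∀ {m} (f : Fin m → Bool) → (∀ {i j} → f i ≡ true → f j ≡ true → i ≡ j) →
                 ∑[ i < m ] indicator (f i) ≤ 1
∑-indicator-≤1 {zero}  f unique = z≤n
∑-indicator-≤1 {suc m} f unique with f zero in f₀
... | true  = ≤-reflexive (cong suc rest≡0)
  where
  rest-false : ∀ i → indicator (f (suc i)) ≡ 0
  rest-false i with f (suc i) in fᵢ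
  ... | true  with () ← unique f₀ fᵢ
  ... | false = refl
  rest≡0 : ∑[ i < m ] indicator (f (suc i)) ≡ 0
  rest≡0 = trans (sum-cong-≗ rest-false) (sum-replicate-zero m)
... | false = ∑-indicator-≤1 (λ i → f (suc i)) (λ p q → fsuc-injective (unique p q))

allPairs-++⁻-across : ∀ {R : ℕ → ℕ → Set} xs {ys} → AllPairs R (xs ++ ys) → All (λ x → All (R x) ys) xs
allPairs-++⁻-across []       _            = []
allPairs-++⁻-across (x ∷ xs) (x~ ∷ pairs) = ++⁻ʳ xs x~ ∷ allPairs-++⁻-across xs pairs

sum-mono-across : ∀ xs ys → length xs ≤ length ys → All (λ x → All (x ≤_) ys) xs → sum xs ≤ sum ys
sum-mono-across []       ys       _   _                  = z≤n
sum-mono-across (x ∷ xs) (y ∷ ys) len ((x≤y ∷ _) ∷ x≤ys) =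
  +-mono-≤ x≤y (sum-mono-across xs ys (s≤s⁻¹ len) (All.map All.tail x≤ys))

sum-take≤sum-drop : ∀ a xs → AllPairs _≤_ xs → length xs ≡ a + a → sum (take a xs) ≤ sum (drop a xs)
sum-take≤sum-drop a xs sorted len = sum-mono-across (take a xs) (drop a xs) shorter
  (allPairs-++⁻-across (take a xs) (subst (AllPairs _≤_) (sym (take++drop≡id a xs)) sorted))
  where
  shorter : length (take a xs) ≤ length (drop a xs)
  shorter = begin
    length (take a xs) ≡⟨ length-take a xs ⟩
    a ⊓ length xs      ≤⟨ m⊓n≤m a _ ⟩
    a                  ≡⟨ sym (m+n∸m≡n a a) ⟩
    a + a ∸ a          ≡⟨ cong (_∸ a) (sym len) ⟩
    length xs ∸ a      ≡⟨ sym (length-drop a xs) ⟩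
    length (drop a xs) ∎
    where open ≤-Reasoning

sorted-all-≥2 : ∀ a E ds → AllPairs _≤_ ds → length ds ≡ suc (a + a) → sum ds ≡ E + E →
                E < sum (take (suc a) ds) → All (2 ≤_) ds
sorted-all-≥2 a E (d ∷ xs) (d≤xs ∷ sorted) len total E< = 2≤d ∷ All.map (λ d≤x → ≤-trans 2≤d d≤x) d≤xs
  where
  lower upper : ℕ
  lower = sum (take a xs)
  upper = sum (drop a xs)
  split : d + (lower + upper) ≡ E + E
  split = trans (cong (d +_) (sym (sum-++ (take a xs) (drop a xs))))
                (trans (cong (λ ys → d + sum ys) (take++drop≡id a xs)) total)
  2≤d : 2 ≤ d
  2≤d = +-cancelʳ-≤ (E + E) 2 d (begin
    2 + (E + E)                   ≡⟨ cong suc (sym (+-suc E E)) ⟩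
    suc E + suc E                 ≤⟨ +-mono-≤ E< E< ⟩
    (d + lower) + (d + lower)     ≤⟨ +-monoʳ-≤ (d + lower) (+-monoʳ-≤ d (sum-take≤sum-drop a xs sorted (suc-injective len))) ⟩
    (d + lower) + (d + upper)     ≡⟨ regroup d lower upper ⟩
    d + (d + (lower + upper))     ≡⟨ cong (d +_) split ⟩
    d + (E + E)                   ∎)
    where
    open ≤-Reasoning
    open +-*-Solver
    regroup : ∀ d l u → (d + l) + (d + u) ≡ d + (d + (l + u))
    regroup = solve 3 (λ d l u → (d :+ l) :+ (d :+ u) := d :+ (d :+ (l :+ u))) refl

<ᵇ-exclusive : ∀ a b → a ≢ b → indicator (a <ᵇ b) + indicator (b <ᵇ a) ≡ 1
<ᵇ-exclusive zero    zero    a≢b = ⊥-elim (a≢b refl)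
<ᵇ-exclusive zero    (suc b) a≢b = refl
<ᵇ-exclusive (suc a) zero    a≢b = refl
<ᵇ-exclusive (suc a) (suc b) a≢b = <ᵇ-exclusive a b (λ a≡b → a≢b (cong suc a≡b))

module Degrees {n} (G : Graph n) where

  _≺_ : Fin n → Fin n → Bool
  u ≺ w = toℕ u <ᵇ toℕ w

  counted : Fin n → Fin n → ℕ
  counted u w = indicator (u ≺ w ∧ adj G u w)

  deg-∑ : ∀ v → deg G v ≡ ∑[ w < n ] indicator (adj G v w)
  deg-∑ v = countᵇ-tabulate (adj G v) (λ w → w)

  edgeCount-∑ : edgeCount G ≡ ∑[ u < n ] ∑[ w < n ] counted u w
  edgeCount-∑ = begin
    sum (map row (allFin n))          ≡⟨ cong sum (map-tabulate (λ u → u) row) ⟩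
    sum (tabulate row)                ≡⟨ sum-tabulate row ⟩
    ∑[ u < n ] row u                  ≡⟨ sum-cong-≗ (λ u → countᵇ-tabulate (λ w → u ≺ w ∧ adj G u w) (λ w → w)) ⟩
    ∑[ u < n ] ∑[ w < n ] counted u w ∎
    where
    open ≡-Reasoning
    row : Fin n → ℕ
    row u = countᵇ (λ w → u ≺ w ∧ adj G u w) (allFin n)

  indicator-adj-split : ∀ u w → indicator (adj G u w) ≡ counted u w + counted w u
  indicator-adj-split u w with adj G u w in uw
  ... | false rewrite trans (Graph.sym G w u) uw | ∧-zeroʳ (u ≺ w) | ∧-zeroʳ (w ≺ u) = refl
  ... | true  rewrite trans (Graph.sym G w u) uw | ∧-identityʳ (u ≺ w) | ∧-identityʳ (w ≺ u) =
    sym (<ᵇ-exclusive (toℕ u) (toℕ w) (λ eq → u≢w (toℕ-injective eq)))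
    where
    u≢w : u ≢ w
    u≢w refl with () ← trans (sym uw) (Graph.irrefl G u)

  handshake : ∑[ v < n ] deg G v ≡ edgeCount G + edgeCount G
  handshake = begin
    ∑[ v < n ] deg G v
      ≡⟨ sum-cong-≗ (λ u → trans (deg-∑ u) (sum-cong-≗ (indicator-adj-split u))) ⟩
    ∑[ u < n ] ∑[ w < n ] (counted u w + counted w u)
      ≡⟨ sum-cong-≗ (λ u → ∑-distrib-+ (counted u) (λ w → counted w u)) ⟩
    ∑[ u < n ] (∑[ w < n ] counted u w + ∑[ w < n ] counted w u)
      ≡⟨ ∑-distrib-+ (λ u → ∑[ w < n ] counted u w) (λ u → ∑[ w < n ] counted w u) ⟩
    E + ∑[ u < n ] ∑[ w < n ] counted w u
      ≡⟨ cong (E +_) (∑-comm (λ u w → counted w u)) ⟩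
    E + E
      ≡⟨ sym (cong₂ _+_ edgeCount-∑ edgeCount-∑) ⟩
    edgeCount G + edgeCount G ∎
    where
    open ≡-Reasoning
    E = ∑[ u < n ] ∑[ w < n ] counted u w

  sum-sortedDegrees : sum (sortedDegrees G) ≡ edgeCount G + edgeCount G
  sum-sortedDegrees = begin
    sum (sortedDegrees G)          ≡⟨ sum-↭ (sort-↭ (map (deg G) (allFin n))) ⟩
    sum (map (deg G) (allFin n))   ≡⟨ cong sum (map-tabulate (λ v → v) (deg G)) ⟩
    sum (tabulate (deg G))         ≡⟨ sum-tabulate (deg G) ⟩
    ∑[ v < n ] deg G v             ≡⟨ handshake ⟩
    edgeCount G + edgeCount G      ∎
    where open ≡-Reasoning

  length-sortedDegrees : length (sortedDegrees G) ≡ n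
  length-sortedDegrees = trans (↭-length (sort-↭ (map (deg G) (allFin n))))
                           (trans (length-map (deg G) (allFin n)) (length-tabulate (λ v → v)))

  deg∈sortedDegrees : ∀ v → deg G v ∈ˡ sortedDegrees G
  deg∈sortedDegrees v = ∈-resp-↭ (↭-sym (sort-↭ (map (deg G) (allFin n)))) (∈-map⁺ (deg G) (∈-allFin v))

  annihilation-min-degree : ∀ {a} → IsAnnihilationNumber G a → 2 * a + 1 ≡ n → ∀ v → 2 ≤ deg G v
  annihilation-min-degree {a} (_ , _ , largest) 2a+1≡n v =
    All.lookup (sorted-all-≥2 a (edgeCount G) (sortedDegrees G)
                  (Linked⇒AllPairs ≤-trans (sort-↗ (map (deg G) (allFin n))))
                  (trans length-sortedDegrees n≡) sum-sortedDegrees E<)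
               (deg∈sortedDegrees v)
    where
    n≡ : n ≡ suc (a + a)
    n≡ = trans (sym 2a+1≡n) (trans (+-comm (2 * a) 1) (cong (λ t → suc (a + t)) (+-identityʳ a)))
    E< : edgeCount G < sum (take (suc a) (sortedDegrees G))
    E< = ≰⇒> (λ ≤E → 1+n≰n (largest (suc a) (subst (suc a ≤_) (sym n≡) (s≤s (m≤m+n a a))) ≤E))

  other-neighbour : (∀ v → 2 ≤ deg G v) → ∀ x c → ∃[ w ] (adj G x w ≡ true × w ≢ c)
  other-neighbour min-deg x c with any? (λ w → (adj G x w ≟ᵇ true) ×-dec ¬? (w ≟ c))
  ... | yes found = found
  ... | no none = ⊥-elim (1+n≰n (≤-trans (min-deg x)
                    (subst (_≤ 1) (sym (deg-∑ x)) (∑-indicator-≤1 (adj G x) only-c))))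
    where
    is-c : ∀ {w} → adj G x w ≡ true → w ≡ c
    is-c {w} e = decidable-stable (w ≟ c) (λ w≢c → none (w , e , w≢c))
    only-c : ∀ {i j} → adj G x i ≡ true → adj G x j ≡ true → i ≡ j
    only-c p q = trans (is-c p) (sym (is-c q))

module Walks {n} (G : Graph n) {bad : Fin n → Set} where

  Walk : Fin n → Fin n → Set
  Walk = WalkAvoiding G bad

  start-allowed : ∀ {u w} → Walk u w → ¬ bad u
  start-allowed (here ok)     = ok
  start-allowed (step ok _ _) = ok

  end-allowed : ∀ {u w} → Walk u w → ¬ bad w
  end-allowed (here ok)      = ok
  end-allowed (step _ _ rest) = end-allowed rest

  _++ʷ_ : ∀ {u w x} → Walk u w → Walk w x → Walk u x
  here _        ++ʷ r = r
  step ok e rest ++ʷ r = step ok e (rest ++ʷ r)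

  snocʷ : ∀ {u w x} → Walk u w → adj G w x ≡ true → ¬ bad x → Walk u x
  snocʷ r e ok = r ++ʷ step (end-allowed r) e (here ok)

  reverseʷ : ∀ {u w} → Walk u w → Walk w u
  reverseʷ (here ok)               = here ok
  reverseʷ (step {u} {w} ok e rest) = snocʷ (reverseʷ rest) (trans (Graph.sym G w u) e) ok

  Closed : Subset n → Set
  Closed S = ∀ {z w} → z ∈ S → adj G z w ≡ true → ¬ bad w → w ∈ S

  closed-reach : ∀ {S u y} → Closed S → u ∈ S → Walk u y → y ∈ S
  closed-reach closed u∈S (here _)        = u∈S
  closed-reach closed u∈S (step _ e rest) = closed-reach closed (closed u∈S e (start-allowed rest)) rest

  module _ (bad? : Decidable bad) where

    Exit : Subset n → Set
    Exit S = ∃₂ λ z w → z ∈ S × w ∉ S × adj G z w ≡ true × ¬ bad w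

    exit? : ∀ S → Dec (Exit S)
    exit? S = any? λ z → any? λ w →
      (z ∈? S) ×-dec ¬? (w ∈? S) ×-dec (adj G z w ≟ᵇ true) ×-dec ¬? (bad? w)

    no-exit⇒closed : ∀ {S} → ¬ Exit S → Closed S
    no-exit⇒closed {S} none {z} {w} z∈S e ok = decidable-stable (w ∈? S) (λ w∉S → none (z , w , z∈S , w∉S , e , ok))

    -- Add the far ends of exit edges until none is left; the fuel k bounds the number of
    -- vertices still missing from S.
    grow : ∀ {u} k S → u ∈ S → (∀ {y} → y ∈ S → Walk u y) → n ≤ k + ∣ S ∣ →
           ∃[ K ] (∀ {y} → y ∈ K ⇔ Walk u y)
    grow {u} k S u∈S reached size with exit? S
    ... | no none = S , mk⇔ reached (closed-reach (no-exit⇒closed none) u∈S)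
    grow zero S u∈S reached size | yes (_ , w , _ , w∉S , _) =
      ⊥-elim (w∉S (subst (w ∈_) (sym (∣p∣≡n⇒p≡⊤ (≤-antisym (∣p∣≤n S) size))) ∈⊤))
    grow {u} (suc k) S u∈S reached size | yes (z , w , z∈S , w∉S , e , ok) =
      grow k S′ (p⊆p∪q ⁅ w ⁆ u∈S) reached′
        (≤-trans size (≤-trans (≤-reflexive (sym (+-suc k ∣ S ∣))) (+-monoʳ-≤ k (p⊂q⇒∣p∣<∣q∣ S⊂S′))))
      where
      S′ = S ∪ ⁅ w ⁆
      S⊂S′ : S ⊂ S′
      S⊂S′ = p⊆p∪q ⁅ w ⁆ , w , x∈p∪q⁺ (inj₂ (x∈⁅x⁆ w)) , w∉S
      reached′ : ∀ {y} → y ∈ S′ → Walk u y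
      reached′ y∈S′ with x∈p∪q⁻ S ⁅ w ⁆ y∈S′
      ... | inj₁ y∈S = reached y∈S
      ... | inj₂ y∈w rewrite x∈⁅y⁆⇒x≡y w y∈w = snocʷ (reached z∈S) e ok

    reachable : ∀ u → ∃[ K ] (∀ {y} → y ∈ K ⇔ Walk u y)
    reachable u with bad? u
    ... | yes bad-u = ⊥ , mk⇔ (λ y∈⊥ → ⊥-elim (∉⊥ y∈⊥)) (λ r → ⊥-elim (start-allowed r bad-u))
    ... | no ok = grow n ⁅ u ⁆ (x∈⁅x⁆ u) (λ y∈u → subst (Walk u) (sym (x∈⁅y⁆⇒x≡y u y∈u)) (here ok))
                    (m≤m+n n ∣ ⁅ u ⁆ ∣)

    walk? : ∀ u y → Dec (Walk u y)
    walk? u y = Dec-map (proj₂ (reachable u)) (y ∈? proj₁ (reachable u))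

module NonCutVertices {n} (G : Graph n) where

  open module W {v : Fin n} = Walks G {λ x → x ≡ v} using (_++ʷ_; reverseʷ; start-allowed; end-allowed)

  Avoiding : Fin n → Fin n → Fin n → Set
  Avoiding v = WalkAvoiding G (λ x → x ≡ v)

  avoiding? : ∀ v u y → Dec (Avoiding v u y)
  avoiding? v = Walks.walk? G (_≟ v)

  component : Fin n → Fin n → Subset n
  component v u = proj₁ (Walks.reachable G (_≟ v) u)

  ∈component⇔ : ∀ v u {y} → y ∈ component v u ⇔ Avoiding v u y
  ∈component⇔ v u = proj₂ (Walks.reachable G (_≟ v) u)

  Separates : Fin n → Fin n → Fin n → Set
  Separates v u w = u ≢ v × w ≢ v × ¬ Avoiding v u w

  IsCutVertex : Fin n → Set
  IsCutVertex v = ∃₂ (Separates v)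

  isCutVertex? : ∀ v → Dec (IsCutVertex v)
  isCutVertex? v = any? λ u → any? λ w → ¬? (u ≟ v) ×-dec ¬? (w ≟ v) ×-dec ¬? (avoiding? v u w)

  ¬cut⇒connectedMinus : ∀ {v} → ¬ IsCutVertex v → ConnectedMinus G v
  ¬cut⇒connectedMinus {v} ¬cut u w u≢v w≢v =
    decidable-stable (avoiding? v u w) (λ ¬uw → ¬cut (u , w , u≢v , w≢v , ¬uw))

  separated-from : ∀ {y u w} → Separates y u w → ∀ c → ∃[ x ] (x ≢ y × ¬ Avoiding y x c)
  separated-from {y} {u} {w} (u≢y , w≢y , ¬uw) c with avoiding? y u c | avoiding? y w c
  ... | no ¬uc | _       = u , u≢y , ¬uc
  ... | yes _  | no ¬wc  = w , w≢y , ¬wc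
  ... | yes uc | yes wc  = ⊥-elim (¬uw (uc ++ʷ reverseʷ wc))

  avoid-unreached : ∀ {y c a b} → Avoiding y a b → ¬ Avoiding y a c → Avoiding c a b
  avoid-unreached {y} {c} {a} (here ok) ¬ac =
    here (λ a≡c → ¬ac (subst (Avoiding y a) a≡c (here ok)))
  avoid-unreached {y} {c} {a} (step ok e rest) ¬ac =
    step (λ a≡c → ¬ac (subst (Avoiding y a) a≡c (here ok))) e
         (avoid-unreached rest (λ rc → ¬ac (step ok e rc)))

  -- Cut an arbitrary walk at its first visit to y.
  avoid-until : ∀ {y c a} → WalkAvoiding G NoVertex a y → ¬ Avoiding y a c → y ≢ c → Avoiding c a y
  avoid-until (here _) _ y≢c = here y≢c
  avoid-until {y} {c} {a} (step _ e rest) ¬ac y≢c with a ≟ y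
  ... | yes refl = here y≢c
  ... | no a≢y = step (λ a≡c → ¬ac (subst (Avoiding y a) a≡c (here a≢y))) e
                      (avoid-until rest (λ rc → ¬ac (step a≢y e rc)) y≢c)

  component-shrinks : Connected G → ∀ c x {y u} → y ∈ component c x → u ≢ y → ¬ Avoiding y u c →
                      component y u ⊂ component c x
  component-shrinks conn c x {y} {u} y∈K u≢y ¬uc = inside , y , y∈K , y∉K′
    where
    xy : Avoiding c x y
    xy = Equivalence.to (∈component⇔ c x) y∈K
    uy : Avoiding c u y
    uy = avoid-until (conn u y) ¬uc (end-allowed xy)
    inside : ∀ {z} → z ∈ component y u → z ∈ component c x
    inside z∈K′ = Equivalence.from (∈component⇔ c x)
      (xy ++ʷ (reverseʷ uy ++ʷ avoid-unreached (Equivalence.to (∈component⇔ y u) z∈K′) ¬uc))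
    y∉K′ : y ∉ component y u
    y∉K′ y∈K′ = end-allowed (Equivalence.to (∈component⇔ y u) y∈K′) refl

  AdjacentNonCut : Set
  AdjacentNonCut = ∃₂ λ u w → adj G u w ≡ true × ConnectedMinus G u × ConnectedMinus G w

  module _ (conn : Connected G) (other-neighbour : ∀ x c → ∃[ w ] (adj G x w ≡ true × w ≢ c)) where

    -- If the component of x in G − c contains a cut vertex y, a component of G − y lies
    -- strictly inside it; otherwise x and a neighbour other than c are both non-cut.
    descend : ∀ k c x → x ≢ c → ∣ component c x ∣ < k → AdjacentNonCut
    descend (suc k) c x x≢c size with any? (λ y → (y ∈? component c x) ×-dec isCutVertex? y)
    ... | no none = x , w , xw , non-cut x∈K , non-cut w∈K
      where
      w = proj₁ (other-neighbour x c)
      xw = proj₁ (proj₂ (other-neighbour x c))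
      w≢c = proj₂ (proj₂ (other-neighbour x c))
      non-cut : ∀ {y} → y ∈ component c x → ConnectedMinus G y
      non-cut {y} y∈K = ¬cut⇒connectedMinus (λ cut → none (y , y∈K , cut))
      x∈K : x ∈ component c x
      x∈K = Equivalence.from (∈component⇔ c x) (here x≢c)
      w∈K : w ∈ component c x
      w∈K = Equivalence.from (∈component⇔ c x) (step x≢c xw (here w≢c))
    ... | yes (y , y∈K , _ , _ , separation) with separated-from separation c
    ...   | u , u≢y , ¬uc = descend k y u u≢y
              (<-≤-trans (p⊂q⇒∣p∣<∣q∣ (component-shrinks conn c x y∈K u≢y ¬uc)) (s≤s⁻¹ size))

    adjacent-non-cut : Fin n → AdjacentNonCut
    adjacent-non-cut z with other-neighbour z z
    ... | x , _ , x≢z = descend (suc n) z x x≢z (s≤s (∣p∣≤n (component z x)))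

largest : ∀ {n} {P : Subset n → Set} → Decidable P → ∀ {S₀} → P S₀ →
          ∃[ S ] (P S × ∀ T → P T → ∣ T ∣ ≤ ∣ S ∣)
largest {n} {P} P? {S₀} PS₀ = search n (λ T _ → ∣p∣≤n T)
  where
  search : ∀ k → (∀ T → P T → ∣ T ∣ ≤ k) → ∃[ S ] (P S × ∀ T → P T → ∣ T ∣ ≤ ∣ S ∣)
  search zero    bound = S₀ , PS₀ , λ T PT → ≤-trans (bound T PT) z≤n
  search (suc k) bound with anySubset? (λ S → P? S ×-dec (suc k ≤? ∣ S ∣))
  ... | yes (S , PS , big) = S , PS , λ T PT → ≤-trans (bound T PT) big
  ... | no none = search k bound′
    where
    bound′ : ∀ T → P T → ∣ T ∣ ≤ k
    bound′ T PT with suc k ≤? ∣ T ∣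
    ... | yes big = ⊥-elim (none (T , PT , big))
    ... | no small = s≤s⁻¹ (≰⇒> small)

lemma6 : ∀ (n : ℕ) (G : Graph n) (a : ℕ) →
    Connected G → ClawFree G → IsAnnihilationNumber G a → 2 * a + 1 ≡ n →
    ∃[ v ] ((∃[ S ] (MaximumIndependent G S × v ∉ S)) × ConnectedMinus G v)
lemma6 n G a connected _ annihilation 2a+1≡n
  with adjacent-non-cut connected (other-neighbour (annihilation-min-degree annihilation 2a+1≡n)) vertex
     | largest independent? {⊥} (λ u _ u∈⊥ _ → ⊥-elim (∉⊥ u∈⊥))
  where
  open Degrees G
  open NonCutVertices G
  vertex : Fin n
  vertex = subst Fin (trans (+-comm 1 (2 * a)) 2a+1≡n) zero
  independent? : Decidable (Independent G)
  independent? S = all? λ u → all? λ w → (u ∈? S) →-dec ((w ∈? S) →-dec (adj G u w ≟ᵇ false))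
... | u , w , uw , u-non-cut , w-non-cut | S , maximum with u ∈? S
...   | no u∉S  = u , (S , maximum , u∉S) , u-non-cut
...   | yes u∈S = w , (S , maximum , w∉S) , w-non-cut
  where
  w∉S : w ∉ S
  w∉S w∈S with () ← trans (sym uw) (proj₁ maximum u w u∈S w∈S)
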